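{- Let $G_{<_1,<_2}$ be a finite double-ordered graph. There exists a unique minimal graph $G'$ on the vertex set $V(G)$ such that $E(G)\subseteq E(G')$ and $G'_{<_1,<_2}$ is magical (i.e., $G'_{<_1,<_2}$ is magical and $E(G')\subseteq E(H)$ for every graph $H$ on $V(G)$ with $E(G)\subseteq E(H)$ and $H_{<_1,<_2}$ magical). Moreover, for distinct $u,v\in V(G)$, $u$ and $v$ are adjacent in $G'$ if and only if there exists a mountain-path in $G_{<_1,<_2}$ connecting $u$ and $v$.
   Context: A double-ordered graph $G_{<_1,<_2}$ is a graph with two total orders $<_1,<_2$ on its vertex set; it is magical if for any three distinct vertices $a<_1 b<_1 c$ with $ab,bc\in E(G)$ and $ac\notin E(G)$ we have $b<_2 a$ and $b<_2 c$. A sequence of vertices $x_1,\dots,x_r$ ($r\ge 2$) of $G_{<_1,<_2}$ is a mountain-path (connecting $x_1$ and $x_r$) if $x_1<_1x_2<_1\dots<_1x_r$, $x_ix_{i+1}\in E(G)$ for every $1\le i<r$, and either $x_1<_2 x_j$ for all $2\le j\le r-1$, or $x_r<_2 x_j$ for all $2\le j\le r-1$. -}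

module Defs where

open import Data.Nat using (ℕ; zero; suc)
open import Data.Fin using (Fin; zero; suc; inject₁; fromℕ)
open import Data.Bool using (Bool; true; false)
open import Data.Product using (Σ; _×_; _,_; ∃)
open import Data.Sum using (_⊎_)
open import Relation.Nullary using (¬_)
open import Relation.Binary.PropositionalEquality using (_≡_)
open import Relation.Binary.Structures using (IsStrictTotalOrder)

record Graph (n : ℕ) : Set where
  field
    adj   : Fin n → Fin n → Bool
    sym   : ∀ u v → adj u v ≡ adj v u
    irrefl : ∀ u → adj u u ≡ false

open Graph public

Edge : ∀ {n} → Graph n → Fin n → Fin n → Set
Edge G u v = adj G u v ≡ true

_⊆E_ : ∀ {n} → Graph n → Graph n → Set
G ⊆E H = ∀ u v → Edge G u v → Edge H u v

record DoubleOrder (n : ℕ) : Set₁ where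
  field
    _<₁_ : Fin n → Fin n → Set
    _<₂_ : Fin n → Fin n → Set
    isSTO₁ : IsStrictTotalOrder _≡_ _<₁_
    isSTO₂ : IsStrictTotalOrder _≡_ _<₂_

open DoubleOrder public

Magical : ∀ {n} → DoubleOrder n → Graph n → Set
Magical O G = ∀ a b c → _<₁_ O a b → _<₁_ O b c →
  Edge G a b → Edge G b c → ¬ Edge G a c →
  _<₂_ O b a × _<₂_ O b c

-- A mountain-path x₁ … x_r with r = k + 2 ≥ 2, given as x : Fin (k+2) → V,
-- from x zero to x (fromℕ (suc k)).  Interior vertices are x (suc (inject₁ j)), j : Fin k.
record MountainPath {n : ℕ} (O : DoubleOrder n) (G : Graph n) (k : ℕ) : Set where
  field
    x : Fin (suc (suc k)) → Fin n
    increasing : ∀ (i : Fin (suc k)) → _<₁_ O (x (inject₁ i)) (x (suc i))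
    edges      : ∀ (i : Fin (suc k)) → Edge G (x (inject₁ i)) (x (suc i))
    mountain   : (∀ (j : Fin k) → _<₂_ O (x zero) (x (suc (inject₁ j))))
               ⊎ (∀ (j : Fin k) → _<₂_ O (x (fromℕ (suc k))) (x (suc (inject₁ j))))

first : ∀ {n} {O : DoubleOrder n} {G : Graph n} {k} → MountainPath O G k → Fin n
first P = MountainPath.x P zero

last : ∀ {n} {O : DoubleOrder n} {G : Graph n} {k} → MountainPath O G k → Fin n
last {k = k} P = MountainPath.x P (fromℕ (suc k))

MountainConnected : ∀ {n} → DoubleOrder n → Graph n → Fin n → Fin n → Set
MountainConnected O G u v =
  Σ ℕ λ k → Σ (MountainPath O G k) λ P →
    (first P ≡ u × last P ≡ v) ⊎ (first P ≡ v × last P ≡ u)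

MinimalMagicalSupergraph : ∀ {n} → DoubleOrder n → Graph n → Graph n → Set
MinimalMagicalSupergraph {n} O G G' =
  G ⊆E G' × Magical O G' ×
  (∀ (H : Graph n) → G ⊆E H → Magical O H → G' ⊆E H)

module Submission where

-- Call a <₁-increasing path of G from u to v a *mountain* if all its interior
-- vertices lie <₂-above u, or all lie <₂-above v.  We let G⁺ be the graph in
-- which distinct u, v are adjacent iff a mountain connects them (in either
-- direction), and show that G⁺ is the unique minimal magical supergraph of G.
--
--   * Mountains are handled as an inductive family 'Walk Q a b' of increasing
--     paths whose interior vertices satisfy Q; these are decidable because <₁
--     is well-founded backwards on the finite set Fin n, so G⁺ is a graph.
--   * G⁺ is magical: two mountains a→b and b→c with a or c below b glue, at b,
--     into a mountain a→c whose floor is the <₂-lower of a and c.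
--   * G⁺ is minimal: in a magical supergraph H, the vertices of a mountain
--     force all shortcuts from its low endpoint, so its endpoints are adjacent.
--   * Uniqueness holds for any two minimal magical supergraphs, by antisymmetry
--     of ⊆E; the mountain-path characterisation translates 'MountainPath'
--     (vertex sequences indexed by Fin) to and from walks.

open import Defs hiding (sym; irrefl)
open import Data.Nat using (ℕ; zero; suc)
open import Data.Fin using (Fin; zero; suc; inject₁; fromℕ)
open import Data.Fin.Properties using (any?)
open import Data.Fin.Induction using (spo-noetherian)
open import Data.Bool using (true)
open import Data.Bool.Properties using (⇔→≡) renaming (_≟_ to _≟ᴮ_)
open import Data.Product using (Σ; _×_; _,_; ∃-syntax; proj₁; proj₂)
open import Data.Sum using (_⊎_; inj₁; inj₂; [_,_]′)
open import Data.Empty using (⊥-elim)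
open import Function using (_∘_; flip)
open import Function.Bundles using (_⇔_; mk⇔; Equivalence)
open import Induction.WellFounded using (Acc; acc)
open import Relation.Nullary using (¬_; Dec; yes; no; does)
open import Relation.Nullary.Decidable using (map; map′; dec-true; dec-false; _×-dec_; _⊎-dec_)
open import Relation.Unary using (_⊆_; Decidable)
open import Relation.Binary.PropositionalEquality using (_≡_; _≢_; refl; sym; trans; subst)
open import Relation.Binary.Definitions using (tri<; tri≈; tri>)
open import Relation.Binary.Structures using (IsStrictTotalOrder)

module _ {n : ℕ} where

  edge? : (H : Graph n) → ∀ u v → Dec (Edge H u v)
  edge? H u v = adj H u v ≟ᴮ true

  edge-sym : (H : Graph n) → ∀ {u v} → Edge H u v → Edge H v u
  edge-sym H {u} {v} e = trans (Graph.sym H v u) e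

  edge-irrefl : (H : Graph n) → ∀ {u v} → Edge H u v → u ≢ v
  edge-irrefl H {u} e refl with trans (sym e) (Graph.irrefl H u)
  ... | ()

  ⊆E-antisym : ∀ {G H : Graph n} → G ⊆E H → H ⊆E G → ∀ u v → adj G u v ≡ adj H u v
  ⊆E-antisym G⊆H H⊆G u v = ⇔→≡ (mk⇔ (G⊆H u v) (H⊆G u v))

  minimal-magical-unique : ∀ {O : DoubleOrder n} {G G₁ G₂ : Graph n} →
    MinimalMagicalSupergraph O G G₁ → MinimalMagicalSupergraph O G G₂ →
    ∀ u v → adj G₂ u v ≡ adj G₁ u v
  minimal-magical-unique {G₁ = G₁} {G₂} (G⊆G₁ , mag₁ , min₁) (G⊆G₂ , mag₂ , min₂) =
    ⊆E-antisym {G₂} {G₁} (min₂ G₁ G⊆G₁ mag₁) (min₁ G₂ G⊆G₂ mag₂)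

  graphOf : (R : Fin n → Fin n → Set) → (∀ u v → Dec (R u v)) →
    (∀ {u v} → R u v → R v u) → (∀ u → ¬ R u u) → Graph n
  graphOf R R? R-sym R-irrefl = record
    { adj    = λ u v → does (R? u v)
    ; sym    = symmetric
    ; irrefl = λ u → dec-false (R? u u) (R-irrefl u)
    }
    where
    symmetric : ∀ u v → does (R? u v) ≡ does (R? v u)
    symmetric u v with R? v u
    ... | yes r = dec-true (R? u v) (R-sym r)
    ... | no ¬r = dec-false (R? u v) (¬r ∘ R-sym)

  graphOf-edge : (R : Fin n → Fin n → Set) (R? : ∀ u v → Dec (R u v))
    (R-sym : ∀ {u v} → R u v → R v u) (R-irrefl : ∀ u → ¬ R u u) → ∀ {u v} →
    Edge (graphOf R R? R-sym R-irrefl) u v ⇔ R u v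
  graphOf-edge R R? R-sym R-irrefl {u} {v} = mk⇔ witness (dec-true (R? u v))
    where
    witness : does (R? u v) ≡ true → R u v
    witness e with R? u v
    ... | yes r = r
    witness () | no _

module _ {n : ℕ} (O : DoubleOrder n) where

  open DoubleOrder O using () renaming (_<₁_ to _≺₁_; _<₂_ to _≺₂_)
  module Ord₁ = IsStrictTotalOrder (isSTO₁ O)
  module Ord₂ = IsStrictTotalOrder (isSTO₂ O)

  magical-completes : ∀ {H : Graph n} → Magical O H → ∀ {a b c} →
    a ≺₁ b → b ≺₁ c → Edge H a b → Edge H b c →
    ¬ b ≺₂ a ⊎ ¬ b ≺₂ c → Edge H a c
  magical-completes {H} magH {a} {b} {c} ab bc eab ebc not-valley with edge? H a c
  ... | yes eac = eac
  ... | no ¬eac with magH a b c ab bc eab ebc ¬eac | not-valley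
  ...   | (ba , _) | inj₁ ¬ba = ⊥-elim (¬ba ba)
  ...   | (_ , bc₂) | inj₂ ¬bc = ⊥-elim (¬bc bc₂)

  _≼₂_ : Fin n → Fin n → Set
  x ≼₂ y = x ≡ y ⊎ x ≺₂ y

  ≼₂-≺₂-trans : ∀ {x y z} → x ≼₂ y → y ≺₂ z → x ≺₂ z
  ≼₂-≺₂-trans (inj₁ refl) yz = yz
  ≼₂-≺₂-trans (inj₂ xy)   yz = Ord₂.trans xy yz

  ≺₂-forced : ∀ {x y} → x ≢ y → ¬ y ≺₂ x → x ≺₂ y
  ≺₂-forced {x} {y} x≢y ¬yx with Ord₂.compare x y
  ... | tri< xy _ _ = xy
  ... | tri≈ _ x≡y _ = ⊥-elim (x≢y x≡y)
  ... | tri> _ _ yx = ⊥-elim (¬yx yx)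

  module MagicalClosure (G : Graph n) where

    data Walk (Q : Fin n → Set) : Fin n → Fin n → Set where
      edge : ∀ {a b} → a ≺₁ b → Edge G a b → Walk Q a b
      step : ∀ {a w b} → a ≺₁ w → Edge G a w → Q w → Walk Q w b → Walk Q a b

    walk-≺₁ : ∀ {Q a b} → Walk Q a b → a ≺₁ b
    walk-≺₁ (edge ab _)     = ab
    walk-≺₁ (step aw _ _ W) = Ord₁.trans aw (walk-≺₁ W)

    walk-weaken : ∀ {Q Q'} → Q ⊆ Q' → ∀ {a b} → Walk Q a b → Walk Q' a b
    walk-weaken Q⊆Q' (edge ab e)     = edge ab e
    walk-weaken Q⊆Q' (step aw e q W) = step aw e (Q⊆Q' q) (walk-weaken Q⊆Q' W)

    walk-join : ∀ {Q a b c} → Walk Q a b → Q b → Walk Q b c → Walk Q a c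
    walk-join (edge ab e)     qb W' = step ab e qb W'
    walk-join (step aw e q W) qb W' = step aw e q (walk-join W qb W')

    walk-unfold : ∀ {Q a b} →
      ((a ≺₁ b × Edge G a b) ⊎ ∃[ w ] (a ≺₁ w × Edge G a w × Q w × Walk Q w b))
      ⇔ Walk Q a b
    walk-unfold = mk⇔ [ (λ (ab , e) → edge ab e) , (λ (_ , aw , e , q , W) → step aw e q W) ]′
                      λ { (edge ab e) → inj₁ (ab , e) ; (step aw e q W) → inj₂ (_ , aw , e , q , W) }

    -- Walks are decidable, by recursion along the backwards well-founded <₁.
    walk? : ∀ {Q} → Decidable Q → ∀ a b → Dec (Walk Q a b)
    walk? {Q} Q? a b = go a (spo-noetherian Ord₁.isStrictPartialOrder a)
      where
      go : ∀ a → Acc (flip _≺₁_) a → Dec (Walk Q a b)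
      go a (acc above) = map walk-unfold ((a Ord₁.<? b ×-dec edge? G a b) ⊎-dec any? via)
        where
        via : ∀ w → Dec (a ≺₁ w × Edge G a w × Q w × Walk Q w b)
        via w with a Ord₁.<? w
        ... | no ¬aw = no (¬aw ∘ proj₁)
        ... | yes aw = map′ (aw ,_) proj₂ (edge? G a w ×-dec (Q? w ×-dec go w (above aw)))

    Mountain : Fin n → Fin n → Set
    Mountain u v = Walk (u ≺₂_) u v ⊎ Walk (v ≺₂_) u v

    Linked : Fin n → Fin n → Set
    Linked u v = Mountain u v ⊎ Mountain v u

    mountain-≺₁ : ∀ {u v} → Mountain u v → u ≺₁ v
    mountain-≺₁ = [ walk-≺₁ , walk-≺₁ ]′

    mountain? : ∀ u v → Dec (Mountain u v)
    mountain? u v = walk? (u Ord₂.<?_) u v ⊎-dec walk? (v Ord₂.<?_) u v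

    linked? : ∀ u v → Dec (Linked u v)
    linked? u v = mountain? u v ⊎-dec mountain? v u

    linked-sym : ∀ {u v} → Linked u v → Linked v u
    linked-sym = [ inj₂ , inj₁ ]′

    linked-irrefl : ∀ u → ¬ Linked u u
    linked-irrefl u l = Ord₁.irrefl refl ([ mountain-≺₁ , mountain-≺₁ ]′ l)

    linked-oriented : ∀ {u v} → u ≺₁ v → Linked u v → Mountain u v
    linked-oriented uv (inj₁ M) = M
    linked-oriented uv (inj₂ M) = ⊥-elim (Ord₁.asym uv (mountain-≺₁ M))

    G⁺ : Graph n
    G⁺ = graphOf Linked linked? linked-sym linked-irrefl

    G⁺-edge : ∀ {u v} → Edge G⁺ u v ⇔ Linked u v
    G⁺-edge = graphOf-edge Linked linked? linked-sym linked-irrefl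

    -- Every edge of G is a one-edge mountain.
    G⊆G⁺ : G ⊆E G⁺
    G⊆G⁺ u v e with Ord₁.compare u v
    ... | tri< uv _ _ = Equivalence.from G⁺-edge (inj₁ (inj₁ (edge uv e)))
    ... | tri≈ _ u≡v _ = ⊥-elim (edge-irrefl G e u≡v)
    ... | tri> _ _ vu = Equivalence.from G⁺-edge (inj₂ (inj₁ (edge vu (edge-sym G e))))

    mountain-above : ∀ {m a b} → m ≼₂ a → m ≼₂ b → Mountain a b → Walk (m ≺₂_) a b
    mountain-above ma mb = [ walk-weaken (≼₂-≺₂-trans ma) , walk-weaken (≼₂-≺₂-trans mb) ]′

    mountain-through : ∀ {m a b c} → m ≼₂ a → m ≼₂ c → a ≺₂ b ⊎ c ≺₂ b →
      Mountain a b → Mountain b c → Walk (m ≺₂_) a c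
    mountain-through ma mc low Mab Mbc =
      walk-join (mountain-above ma (inj₂ mb) Mab) mb (mountain-above (inj₂ mb) mc Mbc)
      where
      mb = [ ≼₂-≺₂-trans ma , ≼₂-≺₂-trans mc ]′ low

    mountain-glue : ∀ {a b c} → a ≺₂ b ⊎ c ≺₂ b → Mountain a b → Mountain b c → Mountain a c
    mountain-glue {a} {b} {c} low Mab Mbc with Ord₂.compare a c
    ... | tri< ac _ _   = inj₁ (mountain-through (inj₁ refl) (inj₂ ac) low Mab Mbc)
    ... | tri≈ _ refl _ = inj₁ (mountain-through (inj₁ refl) (inj₁ refl) low Mab Mbc)
    ... | tri> _ _ ca   = inj₂ (mountain-through (inj₂ ca) (inj₁ refl) low Mab Mbc)

    -- If a <₁ b <₁ c with edges ab, bc and b not <₂-below both a and c,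
    -- the two mountains glue and ac is an edge.
    G⁺-magical : Magical O G⁺
    G⁺-magical a b c ab bc eab ebc ¬eac =
      ≺₂-forced (λ b≡a → Ord₁.irrefl (sym b≡a) ab) (¬eac ∘ shortcut ∘ inj₁) ,
      ≺₂-forced (λ b≡c → Ord₁.irrefl b≡c bc) (¬eac ∘ shortcut ∘ inj₂)
      where
      shortcut : a ≺₂ b ⊎ c ≺₂ b → Edge G⁺ a c
      shortcut low = Equivalence.from G⁺-edge (inj₁ (mountain-glue low
        (linked-oriented ab (Equivalence.to G⁺-edge eab))
        (linked-oriented bc (Equivalence.to G⁺-edge ebc))))

    module _ {H : Graph n} (G⊆H : G ⊆E H) (magH : Magical O H) where

      -- A walk w→b above u, starting from an H-neighbour w ≻₂ u of u, is
      -- short-cut step by step from u, ending in the edge u–b.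
      ascent-edge : ∀ {u w b} → u ≺₁ w → Edge H u w → u ≺₂ w → Walk (u ≺₂_) w b → Edge H u b
      ascent-edge uw euw u<w (edge wb e) =
        magical-completes {H} magH uw wb euw (G⊆H _ _ e) (inj₁ (Ord₂.asym u<w))
      ascent-edge uw euw u<w (step wx e u<x W) =
        ascent-edge (Ord₁.trans uw wx)
          (magical-completes {H} magH uw wx euw (G⊆H _ _ e) (inj₁ (Ord₂.asym u<w))) u<x W

      -- A walk a→b above b is short-cut from its far end.
      descent-edge : ∀ {a b} → Walk (b ≺₂_) a b → Edge H a b
      descent-edge (edge ab e) = G⊆H _ _ e
      descent-edge (step aw e b<w W) =
        magical-completes {H} magH aw (walk-≺₁ W) (G⊆H _ _ e) (descent-edge W) (inj₂ (Ord₂.asym b<w))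

      mountain-edge : ∀ {u v} → Mountain u v → Edge H u v
      mountain-edge (inj₁ (edge uv e))        = G⊆H _ _ e
      mountain-edge (inj₁ (step uw e u<w W))  = ascent-edge uw (G⊆H _ _ e) u<w W
      mountain-edge (inj₂ W)                  = descent-edge W

      G⁺-minimal : G⁺ ⊆E H
      G⁺-minimal u v e with Equivalence.to G⁺-edge e
      ... | inj₁ Muv = mountain-edge Muv
      ... | inj₂ Mvu = edge-sym H (mountain-edge Mvu)

    G⁺-minimal-magical : MinimalMagicalSupergraph O G G⁺
    G⁺-minimal-magical = G⊆G⁺ , G⁺-magical , λ H G⊆H magH → G⁺-minimal {H} G⊆H magH

    -- Vertex sequences x₀ <₁ … <₁ x_{k+1} along edges of G with interior in Q:
    -- the Fin-indexed counterpart of Q-walks, as used by 'MountainPath'.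
    record Chain (Q : Fin n → Set) (k : ℕ) : Set where
      field
        x          : Fin (suc (suc k)) → Fin n
        increasing : ∀ (i : Fin (suc k)) → x (inject₁ i) ≺₁ x (suc i)
        edges      : ∀ (i : Fin (suc k)) → Edge G (x (inject₁ i)) (x (suc i))
        interior   : ∀ (j : Fin k) → Q (x (suc (inject₁ j)))

      start end : Fin n
      start = x zero
      end   = x (fromℕ (suc k))

    open Chain using (start; end)

    chain-tail : ∀ {Q k} → Chain Q (suc k) → Chain Q k
    chain-tail C = record
      { x = x ∘ suc ; increasing = increasing ∘ suc ; edges = edges ∘ suc ; interior = interior ∘ suc }
      where open Chain C

    chain→walk : ∀ {Q k} (C : Chain Q k) → Walk Q (start C) (end C)
    chain→walk {k = zero}  C = edge (increasing zero) (edges zero)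
      where open Chain C
    chain→walk {k = suc k} C = step (increasing zero) (edges zero) (interior zero) (chain→walk (chain-tail C))
      where open Chain C

    walk→chain : ∀ {Q a b} → Walk Q a b → Σ ℕ λ k → Σ (Chain Q k) λ C → start C ≡ a × end C ≡ b
    walk→chain {Q} {a} {b} (edge ab e) = 0 , C , refl , refl
      where
      C : Chain Q 0
      C = record { x = λ { zero → a ; (suc _) → b } ; increasing = λ { zero → ab }
                 ; edges = λ { zero → e } ; interior = λ () }
    walk→chain {Q} {a} (step aw e q W) with walk→chain W
    ... | k , C , refl , end≡b = suc k , C' , refl , end≡b
      where
      open Chain C
      C' : Chain Q (suc k)
      C' = record
        { x          = λ { zero → a ; (suc i) → x i }
        ; increasing = λ { zero → aw ; (suc i) → increasing i }
        ; edges      = λ { zero → e ; (suc i) → edges i }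
        ; interior   = λ { zero → q ; (suc j) → interior j }
        }

    mountainPath→mountain : ∀ {k} (P : MountainPath O G k) → Mountain (first P) (last P)
    mountainPath→mountain P =
      [ (λ above-first → inj₁ (chain→walk (chainOf above-first)))
      , (λ above-last  → inj₂ (chain→walk (chainOf above-last))) ]′ mountain
      where
      open MountainPath P
      chainOf : ∀ {Q} → (∀ j → Q (x (suc (inject₁ j)))) → Chain Q _
      chainOf int = record { x = x ; increasing = increasing ; edges = edges ; interior = int }

    chain→mountainPath : ∀ {Q k} (C : Chain Q k) →
      (∀ j → start C ≺₂ Chain.x C (suc (inject₁ j))) ⊎ (∀ j → end C ≺₂ Chain.x C (suc (inject₁ j))) →
      MountainPath O G k
    chain→mountainPath C m = record { x = Chain.x C ; increasing = Chain.increasing C ; edges = Chain.edges C ; mountain = m }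

    mountain→mountainPath : ∀ {u v} → Mountain u v →
      Σ ℕ λ k → Σ (MountainPath O G k) λ P → first P ≡ u × last P ≡ v
    mountain→mountainPath (inj₁ W) with walk→chain W
    ... | k , C , start≡u , end≡v =
      k , chain→mountainPath C (inj₁ (subst (_≺₂ _) (sym start≡u) ∘ Chain.interior C)) , start≡u , end≡v
    mountain→mountainPath (inj₂ W) with walk→chain W
    ... | k , C , start≡u , end≡v =
      k , chain→mountainPath C (inj₂ (subst (_≺₂ _) (sym end≡v) ∘ Chain.interior C)) , start≡u , end≡v

    connected⇔linked : ∀ {u v} → MountainConnected O G u v ⇔ Linked u v
    connected⇔linked = mk⇔ to from
      where
      to : ∀ {u v} → MountainConnected O G u v → Linked u v
      to (_ , P , inj₁ (refl , refl)) = inj₁ (mountainPath→mountain P)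
      to (_ , P , inj₂ (refl , refl)) = inj₂ (mountainPath→mountain P)
      from : ∀ {u v} → Linked u v → MountainConnected O G u v
      from (inj₁ M) with mountain→mountainPath M
      ... | k , P , ends = k , P , inj₁ ends
      from (inj₂ M) with mountain→mountainPath M
      ... | k , P , ends = k , P , inj₂ ends

lemma5 : ∀ (n : ℕ) (O : DoubleOrder n) (G : Graph n) →
    Σ (Graph n) λ G' →
      MinimalMagicalSupergraph O G G' ×
      (∀ (G'' : Graph n) → MinimalMagicalSupergraph O G G'' → ∀ u v → adj G'' u v ≡ adj G' u v) ×
      (∀ (u v : Fin n) → ¬ u ≡ v → (Edge G' u v ⇔ MountainConnected O G u v))
lemma5 n O G =
  G⁺ , G⁺-minimal-magical ,
  (λ G'' minimal'' → minimal-magical-unique {O = O} {G} {G⁺} {G''} G⁺-minimal-magical minimal'') ,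
  (λ u v _ → mk⇔ (Equivalence.from connected⇔linked ∘ Equivalence.to G⁺-edge)
                 (Equivalence.from G⁺-edge ∘ Equivalence.to connected⇔linked))
  where open MagicalClosure O G
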